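{- Let $\Omega$ be a many-sorted signature, $\varphi$ a sentence of the form $(Q_1 x_1:s_1)\cdots(Q_k x_k:s_k)\bigvee_{i=1}^m\bigwedge_{j=1}^{n_i} L_{ij}$, $\psi$ the Skolem normal form of its negation over the extended signature $\Omega^{sk}$, and $\mathcal{A}$ an $\Omega^{sk}$-structure such that for every $q\in U_\exists\cup E$ every element of $\mathcal{A}_{s_q}$ is the value in $\mathcal{A}$ of some ground $\Omega$-term of sort $s_q$. Let $\Phi$ be any set of refutation witnesses for $\psi$ built from $\mathcal{A}$. Then $\mathcal{A}\models\psi$ if and only if $\mathcal{A}\models\Phi$.
   Context: Many-sorted first-order logic. In $\varphi$, the $L_{ij}$ are literals (atoms or negated atoms), $x_1,\ldots,x_k$ are the (distinct) variables occurring in them, of sorts $s_1,\ldots,s_k$, and $Q_q\in\{\forall,\exists\}$. The negation of $\varphi$ is taken in the form $(\overline{Q}_1 x_1:s_1)\cdots(\overline{Q}_k x_k:s_k)\bigwedge_{i=1}^m\bigvee_{j=1}^{n_i}\neg L_{ij}$, where $\overline{\forall}=\exists$, $\overline{\exists}=\forall$ (and $\neg\neg A$ is identified with $A$). Let $U=\{q:\overline{Q}_q=\forall\}$, $E=\{1,\ldots,k\}\setminus U$; for $\epsilon\in E$ let $U_\epsilon=\{\upsilon\in U:\upsilon<\epsilon\}$ and $w_\epsilon$ the sequence of sorts $s_\upsilon$, $\upsilon\in U_\epsilon$, in increasing order of $\upsilon$. Let $U_\exists=\bigcup_{\epsilon\in E}U_\epsilon$ (universally quantified variables occurring before some existential one)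 and $U_\forall=U\setminus U_\exists$. $\Omega^{sk}$ extends $\Omega$ with fresh Skolem function symbols $sk_\epsilon:w_\epsilon\to s_\epsilon$ for $\epsilon\in E$ (constants if $U_\epsilon=\emptyset$). The Skolem normal form is $\psi=(\forall x_\upsilon:s_\upsilon)_{\upsilon\in U}\bigwedge_{i}\bigvee_{j}\neg L_{ij}(e_1,\ldots,e_k)$ (quantifiers in increasing order of $\upsilon$), where $\neg L_{ij}(e_1,\ldots,e_k)$ denotes $\neg L_{ij}$ with each $x_q$ replaced by $e_q$, $e_q=x_q$ for $q\in U$ and $e_q=sk_q(x_{\upsilon})_{\upsilon\in U_q}$ for $q\in E$. A set of refutation witnesses $\Phi$ (built from $\mathcal{A}$ as in the claim) contains, for each valuation $\alpha$ assigning to each $x_q$, $q\in U_\exists$, an element of $\mathcal{A}_{s_q}$, one $\Omega$-sentence $\phi_\alpha=(\forall x_q:s_q)_{q\in U_\forall}\bigwedge_i\bigvee_j\neg L_{ij}(e'_1,\ldots,e'_k)$, where $e'_q=x_q$ for $q\in U_\forall$ and, for $q\in U_\exists\cup E$, $e'_q$ is some (arbitrarily chosen) ground $\Omega$-term $t$ of sort $s_q$ whose value in $\mathcal{A}$ equals the value of $e_q$ in $\mathcal{A}$ under $\alpha$. -}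

module Defs where

open import Data.Bool using (Bool; true; false; T; not; _∧_; _∨_)
open import Data.Unit using (⊤; tt)
open import Data.Empty using (⊥; ⊥-elim)
open import Data.Nat using (ℕ; zero; suc)
import Data.Nat as ℕ
open import Data.Fin using (Fin; toℕ)
import Data.Fin as Fin
open import Data.List using (List; []; _∷_; map; allFin)
open import Data.List.Relation.Unary.All using (All; []; _∷_)
open import Data.List.Relation.Unary.Any using (Any)
open import Data.Product using (Σ; _×_; _,_; proj₁; proj₂)
open import Data.Sum using (_⊎_; inj₁; inj₂)
open import Relation.Binary.PropositionalEquality using (_≡_; refl; subst; sym)
open import Relation.Nullary using (¬_)

record Signature : Set₁ where
  field
    Sort  : Set
    Fun   : Set
    arity : Fun → List Sort
    res   : Fun → Sort
    Rel   : Set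
    rarity : Rel → List Sort

open Signature public

module _ (Ω : Signature) where

  mutual
    data Term (V : Sort Ω → Set) : Sort Ω → Set where
      var : ∀ {s} → V s → Term V s
      app : (f : Fun Ω) → Terms V (arity Ω f) → Term V (res Ω f)

    data Terms (V : Sort Ω → Set) : List (Sort Ω) → Set where
      []  : Terms V []
      _∷_ : ∀ {s ss} → Term V s → Terms V ss → Terms V (s ∷ ss)

  data Atom (V : Sort Ω → Set) : Set where
    rel : (r : Rel Ω) → Terms V (rarity Ω r) → Atom V
    eq  : ∀ {s} → Term V s → Term V s → Atom V

  data Literal (V : Sort Ω → Set) : Set where
    pos : Atom V → Literal V
    neg : Atom V → Literal V

  GroundTerm : Sort Ω → Set
  GroundTerm = Term (λ _ → ⊥)

negLit : ∀ {Ω V} → Literal Ω V → Literal Ω V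
negLit (pos a) = neg a
negLit (neg a) = pos a

module _ {Ω : Signature} {V W : Sort Ω → Set}
         (σ : ∀ {s} → V s → Term Ω W s) where
  mutual
    substT : ∀ {s} → Term Ω V s → Term Ω W s
    substT (var x) = σ x
    substT (app f ts) = app f (substTs ts)

    substTs : ∀ {ss} → Terms Ω V ss → Terms Ω W ss
    substTs [] = []
    substTs (t ∷ ts) = substT t ∷ substTs ts

  substA : Atom Ω V → Atom Ω W
  substA (rel r ts) = rel r (substTs ts)
  substA (eq t u) = eq (substT t) (substT u)

  substL : Literal Ω V → Literal Ω W
  substL (pos a) = pos (substA a)
  substL (neg a) = neg (substA a)

weakenG : ∀ {Ω V s} → GroundTerm Ω s → Term Ω V s
weakenG = substT (λ ())

record Structure (Ω : Signature) : Set₁ where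
  field
    Carrier : Sort Ω → Set
    funI    : (f : Fun Ω) → All Carrier (arity Ω f) → Carrier (res Ω f)
    relI    : (r : Rel Ω) → All Carrier (rarity Ω r) → Set

open Structure public

module _ {Ω : Signature} (A : Structure Ω) {V : Sort Ω → Set}
         (ρ : ∀ {s} → V s → Carrier A s) where
  mutual
    ⟦_⟧ : ∀ {s} → Term Ω V s → Carrier A s
    ⟦ var x ⟧ = ρ x
    ⟦ app f ts ⟧ = funI A f ⟦ ts ⟧*

    ⟦_⟧* : ∀ {ss} → Terms Ω V ss → All (Carrier A) ss
    ⟦ [] ⟧* = []
    ⟦ t ∷ ts ⟧* = ⟦ t ⟧ ∷ ⟦ ts ⟧*

  AtomHolds : Atom Ω V → Set
  AtomHolds (rel r ts) = relI A r ⟦ ts ⟧*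
  AtomHolds (eq t u) = ⟦ t ⟧ ≡ ⟦ u ⟧

  LitHolds : Literal Ω V → Set
  LitHolds (pos a) = AtomHolds a
  LitHolds (neg a) = ¬ AtomHolds a

  CNFHolds : List (List (Literal Ω V)) → Set
  CNFHolds M = All (Any LitHolds) M

⟦_⟧g : ∀ {Ω s} → GroundTerm Ω s → (A : Structure Ω) → Carrier A s
⟦ t ⟧g A = ⟦_⟧ A (λ ()) t

-- Variables x_1..x_k (indices Fin k) of sorts `sorts q`, and the
-- subfamily of those whose index satisfies a Boolean predicate P

module _ (Ω : Signature) {k : ℕ} (sorts : Fin k → Sort Ω) where
  VarP : (Fin k → Bool) → Sort Ω → Set
  VarP P s = Σ (Fin k) (λ q → T (P q) × sorts q ≡ s)

  VarAll : Sort Ω → Set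
  VarAll = VarP (λ _ → true)

  Valuation : (A : Structure Ω) → (Fin k → Bool) → Set
  Valuation A P = (q : Fin k) → T (P q) → Carrier A (sorts q)

  env : {A : Structure Ω} {P : Fin k → Bool} → Valuation A P →
        ∀ {s} → VarP P s → Carrier A s
  env α (q , p , refl) = α q p

-- a universal sentence in clausal form:
--   (∀ x_q : s_q)_{q : bound q} ⋀_i ⋁_j L_ij
record UnivCNF (Ω : Signature) : Set where
  field
    k      : ℕ
    sorts  : Fin k → Sort Ω
    bound  : Fin k → Bool
    matrix : List (List (Literal Ω (VarP Ω sorts bound)))

_⊨_ : ∀ {Ω} → Structure Ω → UnivCNF Ω → Set
_⊨_ {Ω} A S = (α : Valuation Ω (UnivCNF.sorts S) A (UnivCNF.bound S)) →
        CNFHolds A (env Ω (UnivCNF.sorts S) {A} {UnivCNF.bound S} α) (UnivCNF.matrix S)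

module _ {Ω : Signature} {V : Sort Ω → Set} (Occ : ∀ {s} → V s → Set) where
  mutual
    data OccT : ∀ {s} → Term Ω V s → Set where
      here : ∀ {s} {x : V s} → Occ x → OccT (var x)
      inside : ∀ {f ts} → OccTs ts → OccT (app f ts)

    data OccTs : ∀ {ss} → Terms Ω V ss → Set where
      head : ∀ {s ss} {t : Term Ω V s} {ts : Terms Ω V ss} → OccT t → OccTs (t ∷ ts)
      tail : ∀ {s ss} {t : Term Ω V s} {ts : Terms Ω V ss} → OccTs ts → OccTs (t ∷ ts)

  OccA : Atom Ω V → Set
  OccA (rel r ts) = OccTs ts
  OccA (eq t u) = OccT t ⊎ OccT u

  OccL : Literal Ω V → Set
  OccL (pos a) = OccA a
  OccL (neg a) = OccA a

data Quant : Set where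
  ∀q ∃q : Quant

dual : Quant → Quant
dual ∀q = ∃q
dual ∃q = ∀q

isForall : Quant → Bool
isForall ∀q = true
isForall ∃q = false

record PrenexDNF (Ω : Signature) : Set where
  field
    k      : ℕ
    sorts  : Fin k → Sort Ω
    quant  : Fin k → Quant
    -- outer list: disjunction over i; inner lists: conjunction over j
    matrix : List (List (Literal Ω (VarAll Ω sorts)))
    -- x_1,…,x_k are exactly the (distinct) variables occurring in the L_ij
    occurs : (q : Fin k) →
             Any (Any (OccL {Ω} {VarAll Ω sorts} (λ {s} x → proj₁ x ≡ q))) matrix

anyFin : ∀ {n} → (Fin n → Bool) → Bool
anyFin {zero} p = false
anyFin {suc n} p = p Fin.zero ∨ anyFin (λ i → p (Fin.suc i))

filterΣ : ∀ {A : Set} (p : A → Bool) → List A → List (Σ A (λ a → T (p a)))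
filterΣ p [] = []
filterΣ p (a ∷ as) = go (p a) (λ x → x) (filterΣ p as)
  where
  go : (b : Bool) → (T b → T (p a)) → List (Σ _ (λ a → T (p a))) →
       List (Σ _ (λ a → T (p a)))
  go true  h rest = (a , h tt) ∷ rest
  go false h rest = rest

module Skolem {Ω : Signature} (φ : PrenexDNF Ω) where
  open PrenexDNF φ public

  negQuant : Fin k → Quant
  negQuant q = dual (quant q)

  isU : Fin k → Bool
  isU q = isForall (negQuant q)

  isE : Fin k → Bool
  isE q = not (isU q)

  isUε : Fin k → Fin k → Bool
  isUε ε υ = isU υ ∧ (toℕ υ ℕ.<ᵇ toℕ ε)

  isU∃ : Fin k → Bool
  isU∃ υ = anyFin (λ ε → isE ε ∧ isUε ε υ)

  isU∀ : Fin k → Bool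
  isU∀ υ = isU υ ∧ not (isU∃ υ)

  Uε : (ε : Fin k) → List (Σ (Fin k) (λ υ → T (isUε ε υ)))
  Uε ε = filterΣ (isUε ε) (allFin k)

  sortsOf : (P : Fin k → Bool) → List (Σ (Fin k) (λ υ → T (P υ))) → List (Sort Ω)
  sortsOf P [] = []
  sortsOf P ((υ , _) ∷ L) = sorts υ ∷ sortsOf P L

  SkFun : Set
  SkFun = Σ (Fin k) (λ ε → T (isE ε))

  Ωsk : Signature
  Ωsk = record
    { Sort = Sort Ω
    ; Fun = Fun Ω ⊎ SkFun
    ; arity = λ { (inj₁ f) → arity Ω f ; (inj₂ (ε , _)) → sortsOf (isUε ε) (Uε ε) }
    ; res   = λ { (inj₁ f) → res Ω f   ; (inj₂ (ε , _)) → sorts ε }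
    ; Rel = Rel Ω
    ; rarity = rarity Ω
    }

  mutual
    embT : ∀ {V s} → Term Ω V s → Term Ωsk V s
    embT (var x) = var x
    embT (app f ts) = app (inj₁ f) (embTs ts)

    embTs : ∀ {V ss} → Terms Ω V ss → Terms Ωsk V ss
    embTs [] = []
    embTs (t ∷ ts) = embT t ∷ embTs ts

  embL : ∀ {V} → Literal Ω V → Literal Ωsk V
  embL (pos (rel r ts)) = pos (rel r (embTs ts))
  embL (pos (eq t u))   = pos (eq (embT t) (embT u))
  embL (neg (rel r ts)) = neg (rel r (embTs ts))
  embL (neg (eq t u))   = neg (eq (embT t) (embT u))

  reduct : Structure Ωsk → Structure Ω
  reduct A = record { Carrier = Carrier A ; funI = λ f → funI A (inj₁ f) ; relI = relI A }

  skArgs : (P : Fin k → Bool) (ε : Fin k) → (∀ υ → T (isUε ε υ) → T (P υ)) →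
           (L : List (Σ (Fin k) (λ υ → T (isUε ε υ)))) →
           Terms Ωsk (VarP Ωsk sorts P) (sortsOf (isUε ε) L)
  skArgs P ε h [] = []
  skArgs P ε h ((υ , p) ∷ L) = var (υ , h υ p , refl) ∷ skArgs P ε h L

  eTermAux : (P : Fin k → Bool) →
             (∀ ε υ → T (isE ε) → T (isUε ε υ) → T (P υ)) →
             (q : Fin k) → (T (isU q) → T (P q)) →
             (b : Bool) → isU q ≡ b → Term Ωsk (VarP Ωsk sorts P) (sorts q)
  eTermAux P h q hq true  e = var (q , hq (subst T (sym e) tt) , refl)
  eTermAux P h q hq false e =
    app (inj₂ (q , subst (λ b → T (not b)) (sym e) tt))
        (skArgs P q (λ υ → h q υ (subst (λ b → T (not b)) (sym e) tt)) (Uε q))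

  eTerm : (P : Fin k → Bool) →
          (∀ ε υ → T (isE ε) → T (isUε ε υ) → T (P υ)) →
          (q : Fin k) → (T (isU q) → T (P q)) → Term Ωsk (VarP Ωsk sorts P) (sorts q)
  eTerm P h q hq = eTermAux P h q hq (isU q) refl

  ∧-l : ∀ {a b} → T (a ∧ b) → T a
  ∧-l {true} _ = tt

  anyFin-intro : ∀ {n} (p : Fin n → Bool) (i : Fin n) → T (p i) → T (anyFin p)
  anyFin-intro p Fin.zero h with p Fin.zero
  ... | true = tt
  anyFin-intro p (Fin.suc i) h with p Fin.zero
  ... | true = tt
  ... | false = anyFin-intro (λ j → p (Fin.suc j)) i h

  ∧-intro : ∀ {a b} → T a → T b → T (a ∧ b)
  ∧-intro {true} {true} _ _ = tt

  Uε⊆U : ∀ ε υ → T (isE ε) → T (isUε ε υ) → T (isU υ)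
  Uε⊆U ε υ _ p = ∧-l p

  Uε⊆U∃ : ∀ ε υ → T (isE ε) → T (isUε ε υ) → T (isU∃ υ)
  Uε⊆U∃ ε υ e p = anyFin-intro (λ ε' → isE ε' ∧ isUε ε' υ) ε (∧-intro e p)

  U∃∪E-U : ∀ q → T (isU∃ q ∨ isE q) → T (isU q) → T (isU∃ q)
  U∃∪E-U q h u with isU q | isU∃ q
  ... | true | true = tt
  ... | true | false = h
  ... | false | _ = ⊥-elim u

  ¬U∀⇒U∃∪E : ∀ q → T (not (isU∀ q)) → T (isU∃ q ∨ isE q)
  ¬U∀⇒U∃∪E q h with isU q | isU∃ q
  ... | true  | true  = tt
  ... | true  | false = h
  ... | false | true  = tt
  ... | false | false = tt

  e : (q : Fin k) → Term Ωsk (VarP Ωsk sorts isU) (sorts q)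
  e q = eTerm isU Uε⊆U q (λ u → u)

  σψ : ∀ {s} → VarAll Ωsk sorts s → Term Ωsk (VarP Ωsk sorts isU) s
  σψ (q , _ , refl) = e q

  ψ : UnivCNF Ωsk
  ψ = record
    { k = k ; sorts = sorts ; bound = isU
    ; matrix = map (map (λ L → substL σψ (embL (negLit L)))) matrix }

  -- the value of e_q in A under a valuation α of the variables x_υ, υ ∈ U_∃
  -- (q ∈ U_∃ ∪ E; e_q only involves variables from U_∃)
  valE : (A : Structure Ωsk) → Valuation Ωsk sorts A isU∃ →
         (q : Fin k) → T (isU∃ q ∨ isE q) → Carrier A (sorts q)
  valE A α q h = ⟦_⟧ A (env Ωsk sorts {A} {isU∃} α) (eTerm isU∃ Uε⊆U∃ q (U∃∪E-U q h))

  -- a set of refutation witnesses Φ = {φ_α} for ψ built from A: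
  -- for each α and each q ∈ U_∃ ∪ E an (arbitrary) ground Ω-term e'_q
  -- whose value equals that of e_q under α
  record RefutationWitnesses (A : Structure Ωsk) : Set where
    field
      pick    : (α : Valuation Ωsk sorts A isU∃) → (q : Fin k) → T (isU∃ q ∨ isE q) →
                GroundTerm Ω (sorts q)
      correct : (α : Valuation Ωsk sorts A isU∃) → (q : Fin k) → (h : T (isU∃ q ∨ isE q)) →
                ⟦ pick α q h ⟧g (reduct A) ≡ valE A α q h

    e′Aux : (α : Valuation Ωsk sorts A isU∃) → (q : Fin k) →
            (b : Bool) → isU∀ q ≡ b → Term Ω (VarP Ω sorts isU∀) (sorts q)
    e′Aux α q true  w = var (q , subst T (sym w) tt , refl)
    e′Aux α q false w =
      weakenG (pick α q (¬U∀⇒U∃∪E q (subst (λ b → T (not b)) (sym w) tt)))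

    e′ : (α : Valuation Ωsk sorts A isU∃) → (q : Fin k) → Term Ω (VarP Ω sorts isU∀) (sorts q)
    e′ α q = e′Aux α q (isU∀ q) refl

    σφ : (α : Valuation Ωsk sorts A isU∃) → ∀ {s} → VarAll Ω sorts s → Term Ω (VarP Ω sorts isU∀) s
    σφ α (q , _ , refl) = e′ α q

    φ_ : (α : Valuation Ωsk sorts A isU∃) → UnivCNF Ω
    φ_ α = record
      { k = k ; sorts = sorts ; bound = isU∀
      ; matrix = map (map (λ L → substL (σφ α) (negLit L))) matrix }

  _⊨Φ_ : (A : Structure Ωsk) → RefutationWitnesses A → Set
  A ⊨Φ Φ = (α : Valuation Ωsk sorts A isU∃) → reduct A ⊨ RefutationWitnesses.φ_ Φ α

module Submission where

-- Fix a valuation β of the universal variables x_υ (υ ∈ U) of ψ.  It splits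
-- into its restriction α to U_∃ and its restriction γ to U_∀, and conversely
-- every pair (α , γ) merges into such a β.  Under β the term e_q of ψ has the
-- same value as the term e′_q of φ_α under γ: for q ∈ U_∀ both are the
-- variable x_q, and otherwise e′_q is a ground term chosen to denote the value
-- of e_q under α, which only depends on the variables in U_∃.  Hence the
-- instance of ψ's matrix at β and the instance of φ_α's matrix at γ both say
-- that the negated matrix of φ holds when every x_q denotes this common value,
-- and quantifying over β, resp. over (α , γ), gives A ⊨ ψ ⇔ A ⊨ Φ.
--
-- The hypothesis that every element is denoted by a ground Ω-term is what
-- makes a set of refutation witnesses Φ exist.

open import Defs
open import Data.Bool using (Bool; true; false; T; not; _∧_; _∨_)
open import Data.Bool.Properties using (T-∧; T-∨; T-irrelevant)
open import Data.Unit using (tt)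
open import Data.Empty using (⊥-elim)
open import Data.Nat using (suc)
open import Data.Fin using (Fin)
import Data.Fin as Fin
open import Data.List using (List; []; _∷_; map)
open import Data.List.Relation.Unary.All using (All; _∷_)
import Data.List.Relation.Unary.All as All
import Data.List.Relation.Unary.All.Properties as All
open import Data.List.Relation.Unary.Any using (Any)
import Data.List.Relation.Unary.Any as Any
import Data.List.Relation.Unary.Any.Properties as Any
open import Data.Product using (Σ; _,_; proj₁; proj₂; uncurry)
import Data.Product as Product
open import Data.Sum using (inj₁; inj₂)
open import Function using (id)
open import Function.Bundles using (_⇔_; mk⇔; Equivalence)
open import Function.Properties.Equivalence using ()
  renaming (refl to ⇔-refl; sym to ⇔-sym; trans to ⇔-trans)
open import Function.Related.TypeIsomorphisms using (¬-cong-⇔)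
open import Relation.Binary.PropositionalEquality
  using (_≡_; refl; sym; trans; cong; cong₂; subst; module ≡-Reasoning)

open Equivalence using (to; from)

resp-⇔ : ∀ {X : Set} (R : X → Set) {x y : X} → x ≡ y → R x ⇔ R y
resp-⇔ R refl = ⇔-refl

CNF-cong : ∀ {X : Set} {P Q : X → Set} → (∀ x → P x ⇔ Q x) →
           (M : List (List X)) → All (Any P) M ⇔ All (Any Q) M
CNF-cong h M = mk⇔ (All.map (Any.map (to (h _)))) (All.map (Any.map (from (h _))))

CNF-map-cong : ∀ {X Y : Set} {P : X → Set} {Q : Y → Set} (f : Y → X) →
               (∀ y → P (f y) ⇔ Q y) →
               (M : List (List Y)) → All (Any P) (map (map f) M) ⇔ All (Any Q) M
CNF-map-cong f h M = mk⇔
  (λ H → All.map (λ a → Any.map (to (h _)) (Any.map⁻ a)) (All.map⁻ H))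
  (λ H → All.map⁺ (All.map (λ a → Any.map⁺ (Any.map (from (h _)) a)) H))

anyFin-witness : ∀ {n} (p : Fin n → Bool) → T (anyFin p) → Σ (Fin n) (λ i → T (p i))
anyFin-witness {suc n} p h with to T-∨ h
... | inj₁ p0   = Fin.zero , p0
... | inj₂ rest = Product.map Fin.suc id (anyFin-witness (λ i → p (Fin.suc i)) rest)

module Evaluation {Ω : Signature} (B : Structure Ω) where

  Env : (Sort Ω → Set) → Set
  Env V = ∀ {s} → V s → Carrier B s

  _≗ₑ_ : ∀ {V} → Env V → Env V → Set
  _≗ₑ_ {V} ρ ρ′ = ∀ {s} (x : V s) → ρ x ≡ ρ′ x

  _⊚_ : ∀ {V W} → Env W → (∀ {s} → V s → Term Ω W s) → Env V
  (ρ ⊚ σ) x = ⟦_⟧ B ρ (σ x)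

  mutual
    eval-ext : ∀ {V} {ρ ρ′ : Env V} → ρ ≗ₑ ρ′ → ∀ {s} (t : Term Ω V s) →
               ⟦_⟧ B ρ t ≡ ⟦_⟧ B ρ′ t
    eval-ext h (var x)    = h x
    eval-ext h (app f ts) = cong (funI B f) (eval*-ext h ts)

    eval*-ext : ∀ {V} {ρ ρ′ : Env V} → ρ ≗ₑ ρ′ → ∀ {ss} (ts : Terms Ω V ss) →
                ⟦_⟧* B ρ ts ≡ ⟦_⟧* B ρ′ ts
    eval*-ext h []       = refl
    eval*-ext h (t ∷ ts) = cong₂ _∷_ (eval-ext h t) (eval*-ext h ts)

  mutual
    eval-subst : ∀ {V W} (σ : ∀ {s} → V s → Term Ω W s) (ρ : Env W) →
                 ∀ {s} (t : Term Ω V s) → ⟦_⟧ B ρ (substT σ t) ≡ ⟦_⟧ B (ρ ⊚ σ) t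
    eval-subst σ ρ (var x)    = refl
    eval-subst σ ρ (app f ts) = cong (funI B f) (eval*-subst σ ρ ts)

    eval*-subst : ∀ {V W} (σ : ∀ {s} → V s → Term Ω W s) (ρ : Env W) →
                  ∀ {ss} (ts : Terms Ω V ss) → ⟦_⟧* B ρ (substTs σ ts) ≡ ⟦_⟧* B (ρ ⊚ σ) ts
    eval*-subst σ ρ []       = refl
    eval*-subst σ ρ (t ∷ ts) = cong₂ _∷_ (eval-subst σ ρ t) (eval*-subst σ ρ ts)

  eval-weakenG : ∀ {V} (ρ : Env V) {s} (t : GroundTerm Ω s) →
                 ⟦_⟧ B ρ (weakenG {Ω} {V} t) ≡ ⟦ t ⟧g B
  eval-weakenG ρ t = trans (eval-subst (λ ()) ρ t) (eval-ext (λ ()) t)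

  AtomHolds-ext : ∀ {V} {ρ ρ′ : Env V} → ρ ≗ₑ ρ′ →
                  (a : Atom Ω V) → AtomHolds B ρ a ⇔ AtomHolds B ρ′ a
  AtomHolds-ext h (rel r ts) = resp-⇔ (relI B r) (eval*-ext h ts)
  AtomHolds-ext h (eq t u)   = resp-⇔ (uncurry _≡_) (cong₂ _,_ (eval-ext h t) (eval-ext h u))

  LitHolds-ext : ∀ {V} {ρ ρ′ : Env V} → ρ ≗ₑ ρ′ →
                 (L : Literal Ω V) → LitHolds B ρ L ⇔ LitHolds B ρ′ L
  LitHolds-ext h (pos a) = AtomHolds-ext h a
  LitHolds-ext h (neg a) = ¬-cong-⇔ (AtomHolds-ext h a)

  AtomHolds-subst : ∀ {V W} (σ : ∀ {s} → V s → Term Ω W s) (ρ : Env W) →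
                    (a : Atom Ω V) → AtomHolds B ρ (substA σ a) ⇔ AtomHolds B (ρ ⊚ σ) a
  AtomHolds-subst σ ρ (rel r ts) = resp-⇔ (relI B r) (eval*-subst σ ρ ts)
  AtomHolds-subst σ ρ (eq t u)   =
    resp-⇔ (uncurry _≡_) (cong₂ _,_ (eval-subst σ ρ t) (eval-subst σ ρ u))

  LitHolds-subst : ∀ {V W} (σ : ∀ {s} → V s → Term Ω W s) (ρ : Env W) →
                   (L : Literal Ω V) → LitHolds B ρ (substL σ L) ⇔ LitHolds B (ρ ⊚ σ) L
  LitHolds-subst σ ρ (pos a) = AtomHolds-subst σ ρ a
  LitHolds-subst σ ρ (neg a) = ¬-cong-⇔ (AtomHolds-subst σ ρ a)

open Evaluation using (_≗ₑ_; _⊚_; eval-weakenG; LitHolds-ext; LitHolds-subst)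

module SkolemSemantics {Ω : Signature} (φ : PrenexDNF Ω) (A : Structure (Skolem.Ωsk φ)) where
  open Skolem φ

  mutual
    eval-emb : ∀ {V} (ρ : ∀ {s} → V s → Carrier A s) {s} (t : Term Ω V s) →
               ⟦_⟧ A ρ (embT t) ≡ ⟦_⟧ (reduct A) ρ t
    eval-emb ρ (var x)    = refl
    eval-emb ρ (app f ts) = cong (funI A (inj₁ f)) (eval*-emb ρ ts)

    eval*-emb : ∀ {V} (ρ : ∀ {s} → V s → Carrier A s) {ss} (ts : Terms Ω V ss) →
                ⟦_⟧* A ρ (embTs ts) ≡ ⟦_⟧* (reduct A) ρ ts
    eval*-emb ρ []       = refl
    eval*-emb ρ (t ∷ ts) = cong₂ _∷_ (eval-emb ρ t) (eval*-emb ρ ts)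

  LitHolds-emb : ∀ {V} (ρ : ∀ {s} → V s → Carrier A s) (L : Literal Ω V) →
                 LitHolds A ρ (embL L) ⇔ LitHolds (reduct A) ρ L
  LitHolds-emb ρ (pos (rel r ts)) = resp-⇔ (relI A r) (eval*-emb ρ ts)
  LitHolds-emb ρ (pos (eq t u))   =
    resp-⇔ (uncurry _≡_) (cong₂ _,_ (eval-emb ρ t) (eval-emb ρ u))
  LitHolds-emb ρ (neg (rel r ts)) = ¬-cong-⇔ (LitHolds-emb ρ (pos (rel r ts)))
  LitHolds-emb ρ (neg (eq t u))   = ¬-cong-⇔ (LitHolds-emb ρ (pos (eq t u)))

  U∀⊆U : ∀ q → T (isU∀ q) → T (isU q)
  U∀⊆U q h = proj₁ (to T-∧ h)

  U∃⊆U : ∀ q → T (isU∃ q) → T (isU q)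
  U∃⊆U q h with anyFin-witness (λ ε → isE ε ∧ isUε ε q) h
  ... | ε , r with to T-∧ r
  ...   | ε∈E , q∈Uε = Uε⊆U ε q ε∈E q∈Uε

  Val : (Fin k → Bool) → Set
  Val P = Valuation Ωsk sorts A P

  envᵥ : ∀ {P} → Val P → ∀ {s} → VarP Ωsk sorts P s → Carrier A s
  envᵥ {P} = env Ωsk sorts {A} {P}

  Agree : (P P′ : Fin k → Bool) → Val P → Val P′ → Set
  Agree P P′ ρ ρ′ = ∀ q p p′ → ρ q p ≡ ρ′ q p′

  restrict : (P P′ : Fin k → Bool) → (∀ q → T (P q) → T (P′ q)) → Val P′ → Val P
  restrict P P′ P⊆P′ ρ q p = ρ q (P⊆P′ q p)

  restrict-agrees : (P P′ : Fin k → Bool) (P⊆P′ : ∀ q → T (P q) → T (P′ q)) (ρ : Val P′) →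
                    Agree P′ P ρ (restrict P P′ P⊆P′ ρ)
  restrict-agrees P P′ P⊆P′ ρ q p p′ = cong (ρ q) (T-irrelevant p (P⊆P′ q p′))

  -- U = U_∃ ∪ U_∀, so valuations of U_∃ and of U_∀ merge into one of U;
  -- mergeAt decides membership of q in U_∃ through the equation w
  mergeAt : Val isU∃ → Val isU∀ → (q : Fin k) → T (isU q) →
            (b : Bool) → isU∃ q ≡ b → Carrier A (sorts q)
  mergeAt α γ q u true  w = α q (subst T (sym w) tt)
  mergeAt α γ q u false w = γ q (from T-∧ (u , subst (λ b → T (not b)) (sym w) tt))

  merge : Val isU∃ → Val isU∀ → Val isU
  merge α γ q u = mergeAt α γ q u (isU∃ q) refl

  merge-agreesˡ : (α : Val isU∃) (γ : Val isU∀) → Agree isU isU∃ (merge α γ) α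
  merge-agreesˡ α γ q u p = on-U∃ (isU∃ q) refl
    where
    on-U∃ : (b : Bool) (w : isU∃ q ≡ b) → mergeAt α γ q u b w ≡ α q p
    on-U∃ true  w = cong (α q) (T-irrelevant _ _)
    on-U∃ false w = ⊥-elim (subst T w p)

  merge-agreesʳ : (α : Val isU∃) (γ : Val isU∀) → Agree isU isU∀ (merge α γ) γ
  merge-agreesʳ α γ q u p = on-U∀ (isU∃ q) refl
    where
    on-U∀ : (b : Bool) (w : isU∃ q ≡ b) → mergeAt α γ q u b w ≡ γ q p
    on-U∀ true  w = ⊥-elim (subst (λ b → T (not b)) w (proj₂ (to T-∧ p)))
    on-U∀ false w = cong (γ q) (T-irrelevant _ _)

  -- the value of e_q only depends on the values of the variables x_υ, υ ∈ U_q
  skArgs-agree : ∀ {P P′} (ε : Fin k) (h : ∀ υ → T (isUε ε υ) → T (P υ))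
             (h′ : ∀ υ → T (isUε ε υ) → T (P′ υ)) (L : List (Σ (Fin k) (λ υ → T (isUε ε υ))))
             {ρ : Val P} {ρ′ : Val P′} → Agree P P′ ρ ρ′ →
             ⟦_⟧* A (envᵥ ρ) (skArgs P ε h L) ≡ ⟦_⟧* A (envᵥ ρ′) (skArgs P′ ε h′ L)
  skArgs-agree ε h h′ []              ρ~ρ′ = refl
  skArgs-agree ε h h′ ((υ , p) ∷ L)   ρ~ρ′ =
    cong₂ _∷_ (ρ~ρ′ υ (h υ p) (h′ υ p)) (skArgs-agree ε h h′ L ρ~ρ′)

  eTerm-agree : ∀ {P P′} (h : ∀ ε υ → T (isE ε) → T (isUε ε υ) → T (P υ))
            (h′ : ∀ ε υ → T (isE ε) → T (isUε ε υ) → T (P′ υ)) (q : Fin k)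
            (hq : T (isU q) → T (P q)) (hq′ : T (isU q) → T (P′ q))
            {ρ : Val P} {ρ′ : Val P′} → Agree P P′ ρ ρ′ →
            ⟦_⟧ A (envᵥ ρ) (eTerm P h q hq) ≡ ⟦_⟧ A (envᵥ ρ′) (eTerm P′ h′ q hq′)
  eTerm-agree {P} {P′} h h′ q hq hq′ {ρ} {ρ′} ρ~ρ′ = by-kind (isU q) refl
    where
    by-kind : (b : Bool) (w : isU q ≡ b) →
              ⟦_⟧ A (envᵥ ρ) (eTermAux P h q hq b w) ≡ ⟦_⟧ A (envᵥ ρ′) (eTermAux P′ h′ q hq′ b w)
    by-kind true  w = ρ~ρ′ q _ _
    by-kind false w = cong (funI A _) (skArgs-agree q _ _ (Uε q) ρ~ρ′)

  e-var : (β : Val isU) (q : Fin k) (u : T (isU q)) → ⟦_⟧ A (envᵥ β) (e q) ≡ β q u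
  e-var β q u = by-kind (isU q) refl
    where
    by-kind : (b : Bool) (w : isU q ≡ b) →
              ⟦_⟧ A (envᵥ β) (eTermAux isU Uε⊆U q id b w) ≡ β q u
    by-kind true  w = cong (β q) (T-irrelevant _ _)
    by-kind false w = ⊥-elim (subst T w u)

  NegMatrixHolds : (∀ {s} → VarAll Ω sorts s → Carrier A s) → Set
  NegMatrixHolds τ = All (Any (λ L → LitHolds (reduct A) τ (negLit L))) matrix

  NegMatrixHolds-ext : ∀ {τ τ′ : ∀ {s} → VarAll Ω sorts s → Carrier A s} →
                       _≗ₑ_ (reduct A) τ τ′ → NegMatrixHolds τ ⇔ NegMatrixHolds τ′
  NegMatrixHolds-ext τ≗τ′ = CNF-cong (λ L → LitHolds-ext (reduct A) τ≗τ′ (negLit L)) matrix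

  ψ-instance : (β : Val isU) →
               CNFHolds A (envᵥ β) (UnivCNF.matrix ψ) ⇔ NegMatrixHolds (_⊚_ A (envᵥ β) σψ)
  ψ-instance β = CNF-map-cong _
    (λ L → ⇔-trans (LitHolds-subst A σψ (envᵥ β) (embL (negLit L)))
                   (LitHolds-emb (_⊚_ A (envᵥ β) σψ) (negLit L)))
    matrix

  module Witnesses (Φ : RefutationWitnesses A) where
    open RefutationWitnesses Φ

    envᵣ : Val isU∀ → ∀ {s} → VarP Ω sorts isU∀ s → Carrier A s
    envᵣ = env Ω sorts {reduct A} {isU∀}

    φ-instance : (α : Val isU∃) (γ : Val isU∀) →
                 CNFHolds (reduct A) (envᵣ γ) (UnivCNF.matrix (φ_ α))
                   ⇔ NegMatrixHolds (_⊚_ (reduct A) (envᵣ γ) (σφ α))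
    φ-instance α γ = CNF-map-cong _
      (λ L → LitHolds-subst (reduct A) (σφ α) (envᵣ γ) (negLit L)) matrix

    e≡e′ : (β : Val isU) (α : Val isU∃) (γ : Val isU∀) → Agree isU isU∃ β α → Agree isU isU∀ β γ →
           (q : Fin k) → ⟦_⟧ A (envᵥ β) (e q) ≡ ⟦_⟧ (reduct A) (envᵣ γ) (e′ α q)
    e≡e′ β α γ β~α β~γ q = by-kind (isU∀ q) refl
      where
      by-kind : (b : Bool) (w : isU∀ q ≡ b) →
                ⟦_⟧ A (envᵥ β) (e q) ≡ ⟦_⟧ (reduct A) (envᵣ γ) (e′Aux α q b w)
      by-kind true w = trans (e-var β q (U∀⊆U q q∈U∀)) (β~γ q _ q∈U∀)
        where q∈U∀ = subst T (sym w) tt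
      by-kind false w = begin
          ⟦_⟧ A (envᵥ β) (e q)
        ≡⟨ eTerm-agree Uε⊆U Uε⊆U∃ q id (U∃∪E-U q h) β~α ⟩
          valE A α q h
        ≡⟨ sym (correct α q h) ⟩
          ⟦ pick α q h ⟧g (reduct A)
        ≡⟨ sym (eval-weakenG (reduct A) (envᵣ γ) (pick α q h)) ⟩
          ⟦_⟧ (reduct A) (envᵣ γ) (weakenG (pick α q h))
        ∎
        where
        open ≡-Reasoning
        h = ¬U∀⇒U∃∪E q (subst (λ b → T (not b)) (sym w) tt)

    instance-⇔ : (β : Val isU) (α : Val isU∃) (γ : Val isU∀) → Agree isU isU∃ β α → Agree isU isU∀ β γ →
                 CNFHolds A (envᵥ β) (UnivCNF.matrix ψ)
                   ⇔ CNFHolds (reduct A) (envᵣ γ) (UnivCNF.matrix (φ_ α))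
    instance-⇔ β α γ β~α β~γ =
      ⇔-trans (ψ-instance β) (⇔-trans (NegMatrixHolds-ext same-values) (⇔-sym (φ-instance α γ)))
      where
      same-values : _≗ₑ_ (reduct A) (_⊚_ A (envᵥ β) σψ) (_⊚_ (reduct A) (envᵣ γ) (σφ α))
      same-values (q , _ , refl) = e≡e′ β α γ β~α β~γ q

proposition4 : (Ω : Signature) (φ : PrenexDNF Ω) →
    let open Skolem φ in
    (A : Structure Ωsk) →
    ((q : Fin k) → T (isU∃ q ∨ isE q) → (a : Carrier A (sorts q)) →
    Σ (GroundTerm Ω (sorts q)) (λ t → ⟦ t ⟧g (reduct A) ≡ a)) →
    (Φ : RefutationWitnesses A) →
    (A ⊨ ψ) ⇔ (A ⊨Φ Φ)
proposition4 Ω φ A _ Φ = mk⇔ ψ⇒Φ Φ⇒ψ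
  where
  open Skolem φ
  open SkolemSemantics φ A
  open Witnesses Φ

  -- an instance (α , γ) of Φ is the instance merge α γ of ψ
  ψ⇒Φ : A ⊨ ψ → A ⊨Φ Φ
  ψ⇒Φ A⊨ψ α γ = to (instance-⇔ (merge α γ) α γ (merge-agreesˡ α γ) (merge-agreesʳ α γ)) (A⊨ψ (merge α γ))

  -- an instance β of ψ is the instance (β|U∃ , β|U∀) of Φ
  Φ⇒ψ : A ⊨Φ Φ → A ⊨ ψ
  Φ⇒ψ A⊨Φ β = from (instance-⇔ β α γ (restrict-agrees isU∃ isU U∃⊆U β) (restrict-agrees isU∀ isU U∀⊆U β)) (A⊨Φ α γ)
    where
    α = restrict isU∃ isU U∃⊆U β
    γ = restrict isU∀ isU U∀⊆U β
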